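{- Let $n\ge 3$ and $K\subseteq\{2,\ldots,n-1\}$. Then $\mathcal{D}(S_K)=F_K$.
   Context: $[n]=\{1,\ldots,n\}$. The generalised Fishburn domain $F_K$ is the set of all linear orders $v$ on $[n]$ such that for all $1\le i<j<k\le n$: if $j\in K$ then $j$ is not ranked last by $v$ among $\{i,j,k\}$, and if $j\notin K$ then $j$ is not ranked first by $v$ among $\{i,j,k\}$. Necklace $S_K$: let $L=\{2,\ldots,n-1\}\setminus K$, with elements $k_1<\cdots<k_s$ of $K$ and $\ell_1<\cdots<\ell_t$ of $L$. Place the numbers $1,\ldots,n$ ("beads") on a circle in the cyclic order $1, k_1,\ldots,k_s, n, \ell_t,\ldots,\ell_1$ (then back to $1$); beads $1,k_1,\ldots,k_s,n$ are white and $\ell_1,\ldots,\ell_t$ are black. A set $X\subseteq[n]$ is $w$-convex if (1) $X$ is an arc (contiguous set) of this circle, (2) $X$ is not a single black bead, and (3) there are no integers $i<j<k$ with $i,k\in X$, $j\notin X$ and $j$ white. A flag of $w$-convex sets is a chain $X_1\subset X_2\subset\cdots\subset X_n=[n]$ of $w$-convex sets with $|X_k|=k$; it defines the linear order $x_1x_2\ldots x_n$ (ranked from top) where $\{x_i\}=X_i\setminus X_{i-1}$, $X_0=\emptyset$. $\mathcal{D}(S_K)$ is the set of all linear orders arising from flags of $w$-convex sets. -}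

module Defs where

open import Data.Nat using (ℕ; zero; suc; _∸_; _≡ᵇ_; _≤_)
open import Data.Bool using (Bool; true; false; _∨_)
open import Data.Fin using (Fin; toℕ; inject₁; fromℕ) renaming (_<_ to _<ᶠ_)
open import Data.Fin.Subset using (Subset; ∣_∣; _⊆_)
  renaming (_∈_ to _∈ₛ_; _∉_ to _∉ₛ_)
open import Data.Vec using (Vec; lookup; toList)
open import Data.List using (List; _++_; filterᵇ; reverse; allFin)
open import Data.List.Membership.Propositional using (_∈_)
open import Data.List.Relation.Unary.Unique.Propositional using (Unique)
open import Data.Product using (Σ; ∃; _×_)
open import Data.Sum using (_⊎_)
open import Relation.Nullary using (¬_)
open import Relation.Binary.PropositionalEquality using (_≡_)
open import Function.Bundles using (_⇔_)

-- Convention: the ground set [n] = {1,…,n} is represented by Fin n,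
-- the Fin element j standing for the integer toℕ j + 1.
-- So "1" is the Fin element with toℕ ≡ 0 and "n" the one with toℕ ≡ n ∸ 1.

-- A linear order on [n], written from the top: v = x₁ x₂ … xₙ,
-- an n-vector of pairwise distinct elements of [n].
IsLinearOrder : (n : ℕ) → Vec (Fin n) n → Set
IsLinearOrder n v = Unique (toList v)

Above : {n : ℕ} → Vec (Fin n) n → Fin n → Fin n → Set
Above {n} v a b = Σ (Fin n) λ p → Σ (Fin n) λ q →
  (p <ᶠ q) × (lookup v p ≡ a) × (lookup v q ≡ b)

FishburnCond : (n : ℕ) → Subset n → Vec (Fin n) n → Set
FishburnCond n K v = (i j k : Fin n) → i <ᶠ j → j <ᶠ k →
  ((j ∈ₛ K → ¬ (Above v i j × Above v k j)) ×
   (j ∉ₛ K → ¬ (Above v j i × Above v j k)))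

InFishburn : (n : ℕ) → Subset n → Vec (Fin n) n → Set
InFishburn n K v = IsLinearOrder n v × FishburnCond n K v

whiteᵇ : (n : ℕ) → Subset n → Fin n → Bool
whiteᵇ n K j = (toℕ j ≡ᵇ 0) ∨ lookup K j ∨ (toℕ j ≡ᵇ (n ∸ 1))

blackᵇ : (n : ℕ) → Subset n → Fin n → Bool
blackᵇ n K j with whiteᵇ n K j
... | true = false
... | false = true

White : (n : ℕ) → Subset n → Fin n → Set
White n K j = whiteᵇ n K j ≡ true

Black : (n : ℕ) → Subset n → Fin n → Set
Black n K j = whiteᵇ n K j ≡ false

-- The necklace S_K read around the circle:
-- 1, k₁, …, kₛ, n, ℓₜ, …, ℓ₁  (and then back to 1).
necklace : (n : ℕ) → Subset n → List (Fin n)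
necklace n K = filterᵇ (whiteᵇ n K) (allFin n) ++ reverse (filterᵇ (blackᵇ n K) (allFin n))

-- X is an arc (contiguous set) of the cyclic sequence c: writing
-- c = as ++ bs ++ cs, X is the set of beads of bs, or of cs ++ as
-- (an arc wrapping around the end of the list).
IsArc : {n : ℕ} → List (Fin n) → Subset n → Set
IsArc {n} c X = Σ (List (Fin n)) λ as → Σ (List (Fin n)) λ bs → Σ (List (Fin n)) λ cs →
  (c ≡ as ++ bs ++ cs) ×
  (((y : Fin n) → (y ∈ₛ X) ⇔ (y ∈ bs)) ⊎
   ((y : Fin n) → (y ∈ₛ X) ⇔ (y ∈ cs ⊎ y ∈ as)))

WConvex : (n : ℕ) → Subset n → Subset n → Set
WConvex n K X =
  IsArc (necklace n K) X ×
  ¬ (Σ (Fin n) λ b → Black n K b × ((y : Fin n) → (y ∈ₛ X) ⇔ (y ≡ b))) ×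
  ¬ (Σ (Fin n) λ i → Σ (Fin n) λ j → Σ (Fin n) λ k →
       (i <ᶠ j) × (j <ᶠ k) × (i ∈ₛ X) × (k ∈ₛ X) × (j ∉ₛ X) × White n K j)

-- A flag of w-convex sets X₁ ⊂ X₂ ⊂ ⋯ ⊂ Xₙ = [n], together with X₀ = ∅.
-- X is indexed by Fin (suc n): X k is the set X_k for k = 0,…,n.
record WFlag (n : ℕ) (K : Subset n) : Set where
  field
    X        : Fin (suc n) → Subset n
    size     : (k : Fin (suc n)) → ∣ X k ∣ ≡ toℕ k
    chain    : (k : Fin n) → X (inject₁ k) ⊆ X (Fin.suc k)
    top      : X (fromℕ n) ≡ Data.Fin.Subset.⊤
    wconvex  : (k : Fin n) → WConvex n K (X (Fin.suc k))

-- The flag F defines the linear order v = x₁ … xₙ with {x_k} = X_k ∖ X_{k-1}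
-- (here the 0-based position k of v holds x_{k+1}).
Defines : {n : ℕ} {K : Subset n} → WFlag n K → Vec (Fin n) n → Set
Defines {n} F v = (k : Fin n) (y : Fin n) →
  ((y ∈ₛ WFlag.X F (Fin.suc k)) × (y ∉ₛ WFlag.X F (inject₁ k))) ⇔ (y ≡ lookup v k)

InD : (n : ℕ) → Subset n → Vec (Fin n) n → Set
InD n K v = IsLinearOrder n v × Σ (WFlag n K) λ F → Defines F v

InInterior : (n : ℕ) → Subset n → Set
InInterior n K = (j : Fin n) → j ∈ₛ K → (1 ≤ toℕ j) × (suc (toℕ j) ≤ n ∸ 1)

-- The prefix sets P_k = {x₁, …, x_k} of a linear order v are the only possible flag defining v,
-- and y is ranked above z iff some P_k contains y but not z. So v ∈ F_K iff no prefix set has a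
-- white hole (i, k ∈ P, white j ∉ P, i < j < k) or a black island (black j ∈ P, i, k ∉ P,
-- i < j < k), and the theorem reduces to: a set with a white bead is w-convex iff it has neither.
-- A set is an arc of a cyclic sequence iff no four beads, in cyclic order, alternate in and out of
-- it. Along the necklace the white beads increase and then the black beads decrease, so comparing
-- the beads of an alternation always exposes a hole or an island; conversely an island, together
-- with a white bead of the set, yields an alternation. Finally x₁ is white because X₁ = {x₁} is
-- w-convex, hence not a single black bead.

module Submission where

open import Defs
open import Data.Bool using (Bool; true; false; T; T?)
open import Data.Bool.Properties using (T-≡; T-∨; ¬-not; ∨-identityʳ)
open import Data.Empty using (⊥-elim) renaming (⊥ to ⊥₀)
open import Data.Fin using (Fin; zero; suc; toℕ; fromℕ; inject₁) renaming (_<_ to _<ᶠ_)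
open import Data.Fin.Induction using (<-weakInduction)
open import Data.Fin.Properties using (toℕ<n; toℕ-fromℕ; toℕ-inject₁; toℕ-injective; <-cmp)
open import Data.Fin.Subset using (Subset; inside; outside; ∣_∣)
  renaming (⊥ to ∅; ⊤ to ⊤ₛ; _∈_ to _∈ₛ_; _∉_ to _∉ₛ_)
open import Data.Fin.Subset.Properties using (_∈?_; ∉⊥; ∣⊥∣≡0; ∣p∣≡n⇒p≡⊤; ∈⊤; ⊆-antisym)
open import Data.List using (List; []; _∷_; _++_; reverse; filterᵇ; tabulate; allFin)
open import Data.List.Properties using (filter-all)
open import Data.List.Membership.Propositional using (_∈_; _∉_)
open import Data.List.Membership.Propositional.Properties
  using (∈-++⁺ˡ; ∈-++⁺ʳ; ∈-++⁻; ∈-filter⁺; ∈-filter⁻; ∈-allFin; ∈-tabulate⁺; ∈-tabulate⁻)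
open import Data.List.Relation.Binary.Permutation.Propositional using (↭-sym; ↭⇒↭ₛ)
open import Data.List.Relation.Binary.Permutation.Propositional.Properties using (↭-reverse)
open import Data.List.Relation.Binary.Permutation.Setoid.Properties using (Unique-resp-↭)
open import Data.List.Relation.Binary.Sublist.Propositional
  using (_⊆_; []; _∷_; _∷ʳ_; ⊆-trans; to∈; from∈; minimum; lookup)
open import Data.List.Relation.Binary.Sublist.Propositional.Properties
  using (∷ˡ⁻; ++⁺; ++⁺ˡ; filter⁺; filter-⊆; reverse⁺; reverse⁻)
open import Data.List.Relation.Unary.All using (All; []; _∷_)
import Data.List.Relation.Unary.All as All
import Data.List.Relation.Unary.All.Properties as All
open import Data.List.Relation.Unary.AllPairs using ([]; _∷_)
open import Data.List.Relation.Unary.Any using (here; there)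
import Data.List.Relation.Unary.Any.Properties as Any
open import Data.List.Relation.Unary.Unique.Propositional using (Unique)
import Data.List.Relation.Unary.Unique.Propositional.Properties as Unique
open import Data.Nat using (ℕ; zero; suc; z≤n; s≤s; _≡ᵇ_; _≤_) renaming (_<_ to _<ℕ_)
open import Data.Nat.Properties
  using ( ≡ᵇ⇒≡; ≡⇒≡ᵇ; >⇒≢; <⇒≢; ≤-<-trans; <-≤-trans; ≤-pred; n≢0⇒n>0; ≤∧≢⇒<; ≮⇒≥; <-irrefl
        ; m<n⇒m<1+n; n<1+n; m≤n⇒m<n∨m≡n)
open import Data.Product using (Σ; ∃; ∃₂; _×_; _,_; proj₁; proj₂)
open import Data.Sum using (_⊎_; inj₁; inj₂; [_,_]′)
open import Data.Unit using (⊤; tt)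
open import Data.Vec using (Vec; []; _∷_; _[_]≔_; toList; here; there) renaming (lookup to lookupᵛ)
open import Data.Vec.Properties using ([]=⇒lookup; lookup⇒[]=)
open import Data.Vec.Membership.Propositional.Properties using (∈-lookup; ∈-toList⁺)
import Data.Vec.Relation.Unary.All.Properties as Allᵛ
open import Data.Vec.Relation.Unary.AllPairs using ([]; _∷_)
open import Data.Vec.Relation.Unary.Unique.Propositional using () renaming (Unique to Uniqueᵛ)
open import Data.Vec.Relation.Unary.Unique.Propositional.Properties using (lookup-injective)
open import Function using (_∘_; id; case_of_)
open import Function.Bundles using (_⇔_; mk⇔; Equivalence)
open import Level using (0ℓ)
open import Relation.Binary.Definitions using (tri<; tri≈; tri>)
open import Relation.Binary.PropositionalEquality using (_≡_; _≢_; refl; sym; trans; cong; subst; setoid)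
open import Relation.Nullary using (¬_; yes; no; ¬?)
open import Relation.Nullary.Decidable using (decidable-stable)
open import Relation.Unary using (Pred; ∁; Decidable)

open Equivalence using (to; from)

module _ {A : Set} where

  ⊆-++⁻ʳ : ∀ {P : Pred A 0ℓ} {x xs p r} → All P p → ¬ P x → x ∷ xs ⊆ p ++ r → x ∷ xs ⊆ r
  ⊆-++⁻ʳ []         ¬px s          = s
  ⊆-++⁻ʳ (_ ∷ ps)   ¬px (_ ∷ʳ s)   = ⊆-++⁻ʳ ps ¬px s
  ⊆-++⁻ʳ (py ∷ _)   ¬px (refl ∷ _) = ⊥-elim (¬px py)

  NoGap : Pred A 0ℓ → List A → Set
  NoGap P c = ∀ {a b d} → a ∷ b ∷ d ∷ [] ⊆ c → P a → ¬ P b → P d → ⊥₀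

  Blocks : Pred A 0ℓ → List A → Set
  Blocks P c = ∃₂ λ p q → ∃ λ r → c ≡ p ++ q ++ r × All (∁ P) p × All P q × All (∁ P) r

  blocks⇒noGap : ∀ {P : Pred A 0ℓ} {c} → Blocks P c → NoGap P c
  blocks⇒noGap (p , q , r , refl , ¬Pp , Pq , ¬Pr) s pa ¬pb pd =
    All.lookup ¬Pr (to∈ (∷ˡ⁻ (⊆-++⁻ʳ Pq ¬pb (∷ˡ⁻ (⊆-++⁻ʳ ¬Pp (λ ¬pa → ¬pa pa) s))))) pd

  noGap⇒blocks : ∀ {P : Pred A 0ℓ} → Decidable P → ∀ c → NoGap P c → Blocks P c
  noGap⇒blocks P? [] _ = [] , [] , [] , refl , [] , [] , []
  noGap⇒blocks P? (x ∷ c) noGap with noGap⇒blocks P? c (λ s → noGap (x ∷ʳ s)) | P? x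
  ... | p , q , r , refl , ¬Pp , Pq , ¬Pr | no ¬px = x ∷ p , q , r , refl , ¬px ∷ ¬Pp , Pq , ¬Pr
  ... | [] , q , r , refl , [] , Pq , ¬Pr | yes px = [] , x ∷ q , r , refl , [] , px ∷ Pq , ¬Pr
  ... | y ∷ p , [] , r , refl , ¬Pp , [] , ¬Pr | yes px =
    [] , x ∷ [] , y ∷ p ++ r , refl , [] , px ∷ [] , All.++⁺ ¬Pp ¬Pr
  ... | y ∷ p , z ∷ q , r , refl , ¬py ∷ _ , pz ∷ _ , _ | yes px =
    ⊥-elim (noGap (refl ∷ refl ∷ ++⁺ˡ p (refl ∷ minimum _)) px ¬py pz)

  ⊆-cons-head : ∀ {P : Pred A 0ℓ} {x a as c} → ¬ P x → P a → a ∷ as ⊆ x ∷ c → x ∷ a ∷ as ⊆ x ∷ c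
  ⊆-cons-head ¬px pa (_ ∷ʳ s)   = refl ∷ s
  ⊆-cons-head ¬px pa (refl ∷ s) = ⊥-elim (¬px pa)

  ∈-++-middle : ∀ {P : Pred A 0ℓ} {p q r y} → All (∁ P) p → All (∁ P) r → P y → y ∈ p ++ q ++ r → y ∈ q
  ∈-++-middle {p = p} {q} ¬Pp ¬Pr py y∈ with ∈-++⁻ p y∈
  ... | inj₁ y∈p = ⊥-elim (All.lookup ¬Pp y∈p py)
  ... | inj₂ y∈qr with ∈-++⁻ q y∈qr
  ...   | inj₁ y∈q = y∈q
  ...   | inj₂ y∈r = ⊥-elim (All.lookup ¬Pr y∈r py)

  ∈-++-outer : ∀ {P : Pred A 0ℓ} {p q r y} → All P q → ¬ P y → y ∈ p ++ q ++ r → y ∈ r ⊎ y ∈ p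
  ∈-++-outer {p = p} {q} Pq ¬py y∈ with ∈-++⁻ p y∈
  ... | inj₁ y∈p = inj₂ y∈p
  ... | inj₂ y∈qr with ∈-++⁻ q y∈qr
  ...   | inj₁ y∈q = ⊥-elim (¬py (All.lookup Pq y∈q))
  ...   | inj₂ y∈r = inj₁ y∈r

  unique-++-disjoint : ∀ {xs ys} {x : A} → Unique (xs ++ ys) → x ∈ xs → x ∉ ys
  unique-++-disjoint {xs = _ ∷ xs} (x∉ ∷ _) (here refl) x∈ys = All.lookup x∉ (∈-++⁺ʳ xs x∈ys) refl
  unique-++-disjoint (_ ∷ u) (there x∈xs) = unique-++-disjoint u x∈xs

  unique-++⁻ʳ : ∀ xs {ys : List A} → Unique (xs ++ ys) → Unique ys
  unique-++⁻ʳ []       u       = u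
  unique-++⁻ʳ (_ ∷ xs) (_ ∷ u) = unique-++⁻ʳ xs u

  unique-reverse : ∀ {xs : List A} → Unique xs → Unique (reverse xs)
  unique-reverse {xs} = Unique-resp-↭ (setoid A) (↭⇒↭ₛ (↭-sym (↭-reverse xs)))

  ⊆-filterᵇ⁺ : ∀ (f : A → Bool) {xs l} → All (T ∘ f) xs → xs ⊆ l → xs ⊆ filterᵇ f l
  ⊆-filterᵇ⁺ f {xs} {l} fxs s =
    subst (_⊆ filterᵇ f l) (filter-all (T? ∘ f) fxs) (filter⁺ (T? ∘ f) (T? ∘ f) {as = xs} {bs = l} (λ { refl → id }) s)

  ⊆-filterᵇ⁻ : ∀ (f : A → Bool) {xs l} → xs ⊆ filterᵇ f l → xs ⊆ l × All (T ∘ f) xs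
  ⊆-filterᵇ⁻ f {l = l} s =
    ⊆-trans s (filter-⊆ (T? ∘ f) l) , All.tabulate λ y∈xs → proj₂ (∈-filter⁻ (T? ∘ f) {xs = l} (lookup s y∈xs))

  pair-⊆-++⁻ : ∀ {x y : A} p {q} → x ∷ y ∷ [] ⊆ p ++ q →
               x ∷ y ∷ [] ⊆ p ⊎ (x ∈ p × y ∈ q) ⊎ x ∷ y ∷ [] ⊆ q
  pair-⊆-++⁻ []      s          = inj₂ (inj₂ s)
  pair-⊆-++⁻ (z ∷ p) (_ ∷ʳ s) with pair-⊆-++⁻ p s
  ... | inj₁ s′                  = inj₁ (z ∷ʳ s′)
  ... | inj₂ (inj₁ (x∈p , y∈q)) = inj₂ (inj₁ (there x∈p , y∈q))
  ... | inj₂ (inj₂ s′)           = inj₂ (inj₂ s′)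
  pair-⊆-++⁻ (z ∷ p) (refl ∷ s) with ∈-++⁻ p (to∈ s)
  ... | inj₁ y∈p = inj₁ (refl ∷ from∈ y∈p)
  ... | inj₂ y∈q = inj₂ (inj₁ (here refl , y∈q))

  tabulate-⊆₂ : ∀ {n} (f : Fin n → A) {i j} → i <ᶠ j → f i ∷ f j ∷ [] ⊆ tabulate f
  tabulate-⊆₂ f {zero}  {suc j} _         = refl ∷ from∈ (∈-tabulate⁺ j)
  tabulate-⊆₂ f {suc i} {suc j} (s≤s i<j) = _ ∷ʳ tabulate-⊆₂ (f ∘ suc) i<j

  tabulate-⊆₃ : ∀ {n} (f : Fin n → A) {i j k} → i <ᶠ j → j <ᶠ k → f i ∷ f j ∷ f k ∷ [] ⊆ tabulate f
  tabulate-⊆₃ f {zero}  {suc j} {suc k} _         (s≤s j<k) = refl ∷ tabulate-⊆₂ (f ∘ suc) j<k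
  tabulate-⊆₃ f {suc i} {suc j} {suc k} (s≤s i<j) (s≤s j<k) = _ ∷ʳ tabulate-⊆₃ (f ∘ suc) i<j j<k

  tabulate-⊆₂⁻ : ∀ {n} (f : Fin n → A) {x y} → x ∷ y ∷ [] ⊆ tabulate f →
                 ∃₂ λ i j → i <ᶠ j × f i ≡ x × f j ≡ y
  tabulate-⊆₂⁻ {suc n} f (_ ∷ʳ s) with tabulate-⊆₂⁻ (f ∘ suc) s
  ... | i , j , i<j , refl , refl = suc i , suc j , s≤s i<j , refl , refl
  tabulate-⊆₂⁻ {suc n} f (refl ∷ s) with ∈-tabulate⁻ (to∈ s)
  ... | j , refl = zero , suc j , s≤s z≤n , refl , refl

-- Arcs of a cyclic list

Alternates : ∀ {n} → Subset n → Fin n → Fin n → Fin n → Fin n → Set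
Alternates X a b d e = (a ∈ₛ X × b ∉ₛ X × d ∈ₛ X × e ∉ₛ X) ⊎ (a ∉ₛ X × b ∈ₛ X × d ∉ₛ X × e ∈ₛ X)

module _ {n : ℕ} {X : Subset n} {c : List (Fin n)} where

  alternates⇒¬noGap∈ : ∀ {a b d e} → a ∷ b ∷ d ∷ e ∷ [] ⊆ c → Alternates X a b d e → ¬ NoGap (_∈ₛ X) c
  alternates⇒¬noGap∈ s (inj₁ (a∈ , b∉ , d∈ , _)) noGap = noGap (⊆-trans (refl ∷ refl ∷ refl ∷ _ ∷ʳ []) s) a∈ b∉ d∈
  alternates⇒¬noGap∈ s (inj₂ (_ , b∈ , d∉ , e∈)) noGap = noGap (∷ˡ⁻ s) b∈ d∉ e∈

  alternates⇒¬noGap∉ : ∀ {a b d e} → a ∷ b ∷ d ∷ e ∷ [] ⊆ c → Alternates X a b d e → ¬ NoGap (_∉ₛ X) c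
  alternates⇒¬noGap∉ s (inj₁ (_ , b∉ , d∈ , e∉)) noGap = noGap (∷ˡ⁻ s) b∉ (λ d∉ → d∉ d∈) e∉
  alternates⇒¬noGap∉ s (inj₂ (a∉ , b∈ , d∉ , _)) noGap =
    noGap (⊆-trans (refl ∷ refl ∷ refl ∷ _ ∷ʳ []) s) a∉ (λ b∉ → b∉ b∈) d∉

  arc⇒blocks : Unique c → IsArc c X → Blocks (_∈ₛ X) c ⊎ Blocks (_∉ₛ X) c
  arc⇒blocks u (as , bs , cs , refl , inj₁ X≈bs) = inj₁ (as , bs , cs , refl , ∉as , ∈bs , ∉cs)
    where
    ∉as : All (_∉ₛ X) as
    ∉as = All.tabulate λ y∈as y∈X → unique-++-disjoint u y∈as (∈-++⁺ˡ (to (X≈bs _) y∈X))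
    ∈bs : All (_∈ₛ X) bs
    ∈bs = All.tabulate λ y∈bs → from (X≈bs _) y∈bs
    ∉cs : All (_∉ₛ X) cs
    ∉cs = All.tabulate λ y∈cs y∈X → unique-++-disjoint (unique-++⁻ʳ as u) (to (X≈bs _) y∈X) y∈cs
  arc⇒blocks u (as , bs , cs , refl , inj₂ X≈cs++as) = inj₂ (as , bs , cs , refl , ∈as , ∉bs , ∈cs)
    where
    ∈as : All (∁ (_∉ₛ X)) as
    ∈as = All.tabulate λ y∈as y∉X → y∉X (from (X≈cs++as _) (inj₂ y∈as))
    ∈cs : All (∁ (_∉ₛ X)) cs
    ∈cs = All.tabulate λ y∈cs y∉X → y∉X (from (X≈cs++as _) (inj₁ y∈cs))
    ∉bs : All (_∉ₛ X) bs
    ∉bs = All.tabulate λ y∈bs y∈X → [ unique-++-disjoint (unique-++⁻ʳ as u) y∈bs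
                                    , (λ y∈as → unique-++-disjoint u y∈as (∈-++⁺ˡ y∈bs))
                                    ]′ (to (X≈cs++as _) y∈X)

  arc⇒¬alternates : Unique c → IsArc c X → ∀ {a b d e} → a ∷ b ∷ d ∷ e ∷ [] ⊆ c → ¬ Alternates X a b d e
  arc⇒¬alternates u arc s alt with arc⇒blocks u arc
  ... | inj₁ blocks = alternates⇒¬noGap∈ s alt (blocks⇒noGap blocks)
  ... | inj₂ blocks = alternates⇒¬noGap∉ s alt (blocks⇒noGap blocks)

  blocks∈⇒arc : (∀ y → y ∈ c) → Blocks (_∈ₛ X) c → IsArc c X
  blocks∈⇒arc complete (p , q , r , refl , ∉p , ∈q , ∉r) =
    p , q , r , refl , inj₁ λ y → mk⇔ (λ y∈X → ∈-++-middle ∉p ∉r y∈X (complete y)) (All.lookup ∈q)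

  blocks∉⇒arc : (∀ y → y ∈ c) → Blocks (_∉ₛ X) c → IsArc c X
  blocks∉⇒arc complete (p , q , r , refl , ∈p , ∉q , ∈r) =
    p , q , r , refl , inj₂ λ y → mk⇔ (λ y∈X → ∈-++-outer ∉q (λ y∉X → y∉X y∈X) (complete y))
                                      [ stable ∈r , stable ∈p ]′
    where
    stable : ∀ {l y} → All (∁ (_∉ₛ X)) l → y ∈ l → y ∈ₛ X
    stable {y = y} ∈l y∈l = decidable-stable (y ∈? X) (All.lookup ∈l y∈l)

module _ {n : ℕ} {X : Subset n} where

  ¬alternates⇒arc : ∀ c → (∀ y → y ∈ c) →
                    (∀ {a b d e} → a ∷ b ∷ d ∷ e ∷ [] ⊆ c → ¬ Alternates X a b d e) → IsArc c X
  ¬alternates⇒arc [] complete noAlt = blocks∈⇒arc complete ([] , [] , [] , refl , [] , [] , [])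
  ¬alternates⇒arc (x ∷ c) complete noAlt with x ∈? X
  ... | no x∉X = blocks∈⇒arc complete (noGap⇒blocks (_∈? X) _ λ s a∈ b∉ d∈ →
          noAlt (⊆-cons-head x∉X a∈ s) (inj₂ (x∉X , a∈ , b∉ , d∈)))
  ... | yes x∈X = blocks∉⇒arc complete (noGap⇒blocks (λ y → ¬? (y ∈? X)) _ λ s a∉ b∈ d∉ →
          noAlt (⊆-cons-head {P = _∉ₛ X} (λ x∉X → x∉X x∈X) a∉ s)
                (inj₁ (x∈X , a∉ , decidable-stable (_ ∈? X) b∈ , d∉)))

-- The necklace

module Necklace {n : ℕ} (K : Subset n) where

  white black : Fin n → Bool
  white = whiteᵇ n K
  black = blackᵇ n K

  T-black : ∀ y → T (black y) ⇔ Black n K y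
  T-black y with white y
  ... | true  = mk⇔ (λ ()) (λ ())
  ... | false = mk⇔ (λ _ → refl) (λ _ → tt)

  NecklaceOrder : Bool → Bool → Fin n → Fin n → Set
  NecklaceOrder true  true  x y = x <ᶠ y
  NecklaceOrder true  false _ _ = ⊤
  NecklaceOrder false true  _ _ = ⊥₀
  NecklaceOrder false false x y = y <ᶠ x

  private
    recolour : ∀ {x y cx cy} → white x ≡ cx → white y ≡ cy → NecklaceOrder cx cy x y →
               NecklaceOrder (white x) (white y) x y
    recolour refl refl o = o

  whites blacks : List (Fin n)
  whites = filterᵇ white (allFin n)
  blacks = filterᵇ black (allFin n)

  ∈-whites⁻ : ∀ {y} → y ∈ whites → White n K y
  ∈-whites⁻ {y} y∈ = to T-≡ (proj₂ (∈-filter⁻ (T? ∘ white) {y} {allFin n} y∈))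

  ∈-blacks⁻ : ∀ {y} → y ∈ blacks → Black n K y
  ∈-blacks⁻ {y} y∈ = to (T-black y) (proj₂ (∈-filter⁻ (T? ∘ black) {y} {allFin n} y∈))

  necklace-unique : Unique (necklace n K)
  necklace-unique =
    Unique.++⁺ (Unique.filter⁺ _ (Unique.allFin⁺ n)) (unique-reverse (Unique.filter⁺ _ (Unique.allFin⁺ n)))
      λ (y∈whites , y∈rev) → case trans (sym (∈-whites⁻ y∈whites)) (∈-blacks⁻ (Any.reverse⁻ y∈rev)) of λ ()

  ∈-necklace : ∀ y → y ∈ necklace n K
  ∈-necklace y with white y in eq
  ... | true  = ∈-++⁺ˡ (∈-filter⁺ (T? ∘ white) (∈-allFin y) (from T-≡ eq))
  ... | false = ∈-++⁺ʳ whites (Any.reverse⁺ (∈-filter⁺ (T? ∘ black) (∈-allFin y) (from (T-black y) eq)))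

  necklace-order : ∀ {x y} → x ∷ y ∷ [] ⊆ necklace n K → NecklaceOrder (white x) (white y) x y
  necklace-order {x} {y} s with pair-⊆-++⁻ whites s
  ... | inj₁ s′ with ⊆-filterᵇ⁻ white s′
  ...   | s″ , wx ∷ wy ∷ [] with tabulate-⊆₂⁻ id s″
  ...     | _ , _ , x<y , refl , refl = recolour (to T-≡ wx) (to T-≡ wy) x<y
  necklace-order s | inj₂ (inj₁ (x∈whites , y∈rev)) =
    recolour (∈-whites⁻ x∈whites) (∈-blacks⁻ (Any.reverse⁻ y∈rev)) tt
  necklace-order {x} {y} s | inj₂ (inj₂ s′) with ⊆-filterᵇ⁻ black (reverse⁻ {as = y ∷ x ∷ []} s′)
  ... | s″ , by ∷ bx ∷ [] with tabulate-⊆₂⁻ id s″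
  ...   | _ , _ , y<x , refl , refl = recolour (to (T-black x) bx) (to (T-black y) by) y<x

  necklace-⊆ : ∀ {ws bs} → All (White n K) ws → ws ⊆ allFin n → All (Black n K) bs → bs ⊆ allFin n →
               ws ++ reverse bs ⊆ necklace n K
  necklace-⊆ Wws ws⊆ Bbs bs⊆ = ++⁺ (⊆-filterᵇ⁺ white (All.map (from T-≡) Wws) ws⊆)
                                   (reverse⁺ (⊆-filterᵇ⁺ black (All.map (λ {y} → from (T-black y)) Bbs) bs⊆))

≡ᵇ-false : ∀ {a b} → a ≢ b → (a ≡ᵇ b) ≡ false
≡ᵇ-false {a} {b} a≢b = ¬-not λ a≡ᵇb → a≢b (≡ᵇ⇒≡ a b (from T-≡ a≡ᵇb))

module _ {m : ℕ} (K : Subset (suc m)) where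

  module _ {i j k : Fin (suc m)} (i<j : i <ᶠ j) (j<k : j <ᶠ k) where

    whiteᵇ-interior : whiteᵇ (suc m) K j ≡ lookupᵛ K j
    whiteᵇ-interior
      rewrite ≡ᵇ-false (>⇒≢ (≤-<-trans z≤n i<j))
            | ≡ᵇ-false (<⇒≢ (<-≤-trans j<k (≤-pred (toℕ<n k)))) = ∨-identityʳ (lookupᵛ K j)

    white⇔∈K : White (suc m) K j ⇔ j ∈ₛ K
    white⇔∈K = mk⇔ (λ w → lookup⇒[]= j K (trans (sym whiteᵇ-interior) w))
                   (λ j∈K → trans whiteᵇ-interior ([]=⇒lookup j∈K))

    black⇔∉K : Black (suc m) K j ⇔ j ∉ₛ K
    black⇔∉K = mk⇔ (λ b j∈K → case trans (sym ([]=⇒lookup j∈K)) (trans (sym whiteᵇ-interior) b) of λ ())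
                   (λ j∉K → trans whiteᵇ-interior (¬-not λ e → j∉K (lookup⇒[]= j K e)))

  black⇒interior : ∀ {b} → Black (suc m) K b → 0 <ℕ toℕ b × toℕ b <ℕ m
  black⇒interior {b} black = n≢0⇒n>0 (notWhite ∘ first) , ≤∧≢⇒< (≤-pred (toℕ<n b)) (notWhite ∘ last)
    where
    notWhite : ¬ T (whiteᵇ (suc m) K b)
    notWhite = subst T black
    first : toℕ b ≡ 0 → T (whiteᵇ (suc m) K b)
    first b≡0 = from T-∨ (inj₁ (≡⇒≡ᵇ _ 0 b≡0))
    last : toℕ b ≡ m → T (whiteᵇ (suc m) K b)
    last b≡m = from (T-∨ {toℕ b ≡ᵇ 0}) (inj₂ (from (T-∨ {lookupᵛ K b}) (inj₂ (≡⇒≡ᵇ _ m b≡m))))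

-- Prefix sets of a linear order

∣p∣≡0⇒∉ : ∀ {n} {p : Subset n} {y} → ∣ p ∣ ≡ 0 → y ∉ₛ p
∣p∣≡0⇒∉ {p = outside ∷ p} ∣p∣≡0 (there y∈) = ∣p∣≡0⇒∉ {p = p} ∣p∣≡0 y∈

insert : ∀ {n} → Fin n → Subset n → Subset n
insert x p = p [ x ]≔ inside

∈-insert⁻ : ∀ {n} {p : Subset n} {x y} → y ∈ₛ insert x p → y ≡ x ⊎ y ∈ₛ p
∈-insert⁻ {p = _ ∷ p} {x = zero}  {zero}  _         = inj₁ refl
∈-insert⁻ {p = _ ∷ p} {x = zero}  {suc y} (there m) = inj₂ (there m)
∈-insert⁻ {p = _ ∷ p} {x = suc x} {zero}  here      = inj₂ here
∈-insert⁻ {p = _ ∷ p} {x = suc x} {suc y} (there m) with ∈-insert⁻ {p = p} m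
... | inj₁ refl = inj₁ refl
... | inj₂ y∈p  = inj₂ (there y∈p)

∈-insert⁺ : ∀ {n} {p : Subset n} {x y} → y ≡ x ⊎ y ∈ₛ p → y ∈ₛ insert x p
∈-insert⁺ {p = _ ∷ p} {x = zero}  {zero}  _                 = here
∈-insert⁺ {p = _ ∷ p} {x = zero}  {suc y} (inj₂ (there m)) = there m
∈-insert⁺ {p = _ ∷ p} {x = suc x} {zero}  (inj₂ here)      = here
∈-insert⁺ {p = _ ∷ p} {x = suc x} {suc y} (inj₁ refl)      = there (∈-insert⁺ {p = p} (inj₁ refl))
∈-insert⁺ {p = _ ∷ p} {x = suc x} {suc y} (inj₂ (there m)) = there (∈-insert⁺ {p = p} (inj₂ m))

∣insert∣ : ∀ {n} {p : Subset n} {x} → x ∉ₛ p → ∣ insert x p ∣ ≡ suc ∣ p ∣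
∣insert∣ {p = outside ∷ p} {x = zero}  _   = refl
∣insert∣ {p = inside  ∷ p} {x = zero}  x∉p = ⊥-elim (x∉p here)
∣insert∣ {p = outside ∷ p} {x = suc x} x∉p = ∣insert∣ {p = p} (x∉p ∘ there)
∣insert∣ {p = inside  ∷ p} {x = suc x} x∉p = cong suc (∣insert∣ {p = p} (x∉p ∘ there))

prefix : ∀ {n k} → Vec (Fin n) k → Fin (suc k) → Subset n
prefix v       zero    = ∅
prefix (x ∷ v) (suc i) = insert x (prefix v i)

∈-prefix⁻ : ∀ {n k} (v : Vec (Fin n) k) i {y} → y ∈ₛ prefix v i →
            ∃ λ p → toℕ p <ℕ toℕ i × lookupᵛ v p ≡ y
∈-prefix⁻ v       zero    y∈ = ⊥-elim (∉⊥ y∈)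
∈-prefix⁻ (x ∷ v) (suc i) y∈ with ∈-insert⁻ {p = prefix v i} y∈
... | inj₁ refl = zero , s≤s z≤n , refl
... | inj₂ y∈′ with ∈-prefix⁻ v i y∈′
...   | p , p<i , refl = suc p , s≤s p<i , refl

∈-prefix⁺ : ∀ {n k} (v : Vec (Fin n) k) i p → toℕ p <ℕ toℕ i → lookupᵛ v p ∈ₛ prefix v i
∈-prefix⁺ (x ∷ v) (suc i) zero    _         = ∈-insert⁺ {p = prefix v i} (inj₁ refl)
∈-prefix⁺ (x ∷ v) (suc i) (suc p) (s≤s p<i) = ∈-insert⁺ {p = prefix v i} (inj₂ (∈-prefix⁺ v i p p<i))

∈-prefix-suc : ∀ {n k} (v : Vec (Fin n) k) i {y} →
               y ∈ₛ prefix v (suc i) ⇔ (y ∈ₛ prefix v (inject₁ i) ⊎ y ≡ lookupᵛ v i)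
∈-prefix-suc v i = mk⇔ split join
  where
  split : ∀ {y} → y ∈ₛ prefix v (suc i) → y ∈ₛ prefix v (inject₁ i) ⊎ y ≡ lookupᵛ v i
  split y∈ with ∈-prefix⁻ v (suc i) y∈
  ... | p , s≤s p≤i , refl with m≤n⇒m<n∨m≡n p≤i
  ...   | inj₁ p<i = inj₁ (∈-prefix⁺ v (inject₁ i) p (subst (toℕ p <ℕ_) (sym (toℕ-inject₁ i)) p<i))
  ...   | inj₂ p≡i = inj₂ (cong (lookupᵛ v) (toℕ-injective p≡i))
  join : ∀ {y} → y ∈ₛ prefix v (inject₁ i) ⊎ y ≡ lookupᵛ v i → y ∈ₛ prefix v (suc i)
  join (inj₁ y∈) with ∈-prefix⁻ v (inject₁ i) y∈
  ... | p , p<i , refl = ∈-prefix⁺ v (suc i) p (m<n⇒m<1+n (subst (toℕ p <ℕ_) (toℕ-inject₁ i) p<i))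
  join (inj₂ refl) = ∈-prefix⁺ v (suc i) i (n<1+n (toℕ i))

uniqueᵛ : ∀ {A : Set} {k} {v : Vec A k} → Unique (toList v) → Uniqueᵛ v
uniqueᵛ {v = []}    []         = []
uniqueᵛ {v = x ∷ v} (x∉v ∷ u) = Allᵛ.toList⁻ x∉v ∷ uniqueᵛ u

∣prefix∣ : ∀ {n k} {v : Vec (Fin n) k} → Unique (toList v) → ∀ i → ∣ prefix v i ∣ ≡ toℕ i
∣prefix∣ {n} _ zero = ∣⊥∣≡0 n
∣prefix∣ {v = x ∷ v} (x∉v ∷ u) (suc i) = trans (∣insert∣ x∉prefix) (cong suc (∣prefix∣ u i))
  where
  x∉prefix : x ∉ₛ prefix v i
  x∉prefix x∈ with ∈-prefix⁻ v i x∈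
  ... | p , _ , vp≡x = All.lookup x∉v (subst (_∈ toList v) vp≡x (∈-toList⁺ (∈-lookup p v))) refl

module LinearOrder {n : ℕ} {v : Vec (Fin n) n} (u : Unique (toList v)) where

  lookup∈prefix : ∀ {p i} → lookupᵛ v p ∈ₛ prefix v i ⇔ toℕ p <ℕ toℕ i
  lookup∈prefix {p} {i} = mk⇔ before (∈-prefix⁺ v i p)
    where
    before : lookupᵛ v p ∈ₛ prefix v i → toℕ p <ℕ toℕ i
    before vp∈ with ∈-prefix⁻ v i vp∈
    ... | q , q<i , vq≡vp with lookup-injective (uniqueᵛ u) q p vq≡vp
    ...   | refl = q<i

  prefix-full : prefix v (fromℕ n) ≡ ⊤ₛ
  prefix-full = ∣p∣≡n⇒p≡⊤ (trans (∣prefix∣ u (fromℕ n)) (toℕ-fromℕ n))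

  occurs : ∀ y → ∃ λ p → lookupᵛ v p ≡ y
  occurs y with ∈-prefix⁻ v (fromℕ n) (subst (y ∈ₛ_) (sym prefix-full) ∈⊤)
  ... | p , _ , vp≡y = p , vp≡y

  separated⇒above : ∀ i {y z} → y ∈ₛ prefix v i → z ∉ₛ prefix v i → Above v y z
  separated⇒above i {z = z} y∈ z∉ with ∈-prefix⁻ v i y∈ | occurs z
  ... | p , p<i , vp≡y | q , refl = p , q , <-≤-trans p<i (≮⇒≥ (z∉ ∘ ∈-prefix⁺ v i q)) , vp≡y , refl

NoWhiteHole : (n : ℕ) → Subset n → Subset n → Set
NoWhiteHole n K X = ∀ {i j k} → i <ᶠ j → j <ᶠ k → White n K j → i ∈ₛ X → k ∈ₛ X → j ∉ₛ X → ⊥₀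

NoBlackIsland : (n : ℕ) → Subset n → Subset n → Set
NoBlackIsland n K X = ∀ {i j k} → i <ᶠ j → j <ᶠ k → Black n K j → j ∈ₛ X → i ∉ₛ X → k ∉ₛ X → ⊥₀

module Fishburn {m : ℕ} {K : Subset (suc m)} {v : Vec (Fin (suc m)) (suc m)}
                (u : Unique (toList v)) where

  open LinearOrder u

  fishburn⇒noWhiteHole : FishburnCond (suc m) K v → ∀ i → NoWhiteHole (suc m) K (prefix v i)
  fishburn⇒noWhiteHole fish l i<j j<k white i∈ k∈ j∉ =
    proj₁ (fish _ _ _ i<j j<k) (to (white⇔∈K K i<j j<k) white)
          (separated⇒above l i∈ j∉ , separated⇒above l k∈ j∉)

  fishburn⇒noBlackIsland : FishburnCond (suc m) K v → ∀ i → NoBlackIsland (suc m) K (prefix v i)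
  fishburn⇒noBlackIsland fish l i<j j<k black j∈ i∉ k∉ =
    proj₂ (fish _ _ _ i<j j<k) (to (black⇔∉K K i<j j<k) black)
          (separated⇒above l j∈ i∉ , separated⇒above l j∈ k∉)

  prefixes⇒fishburn : (∀ i → NoWhiteHole (suc m) K (prefix v i)) →
                      (∀ i → NoBlackIsland (suc m) K (prefix v i)) → FishburnCond (suc m) K v
  prefixes⇒fishburn noHole noIsland i j k i<j j<k = notLast , notFirst
    where
    -- Both witnesses put j at the same position q; the prefix just before q, resp. ending at q,
    -- then separates j from i and k.
    before : ∀ {p} q → toℕ p <ℕ toℕ q → lookupᵛ v p ∈ₛ prefix v (inject₁ q)
    before q p<q = from lookup∈prefix (subst (_ <ℕ_) (sym (toℕ-inject₁ q)) p<q)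

    notLast : j ∈ₛ K → ¬ (Above v i j × Above v k j)
    notLast j∈K ((p , q , p<q , refl , refl) , (p′ , q′ , p′<q′ , refl , vq′≡vq))
      with lookup-injective (uniqueᵛ u) q′ q vq′≡vq
    ... | refl = noHole (inject₁ q) i<j j<k (from (white⇔∈K K i<j j<k) j∈K) (before q p<q) (before q p′<q′)
                   (λ vq∈ → <-irrefl (sym (toℕ-inject₁ q)) (to lookup∈prefix vq∈))

    notFirst : j ∉ₛ K → ¬ (Above v j i × Above v j k)
    notFirst j∉K ((q , p , q<p , refl , refl) , (q′ , p′ , q′<p′ , vq′≡vq , refl))
      with lookup-injective (uniqueᵛ u) q′ q vq′≡vq
    ... | refl = noIsland (suc q) i<j j<k (from (black⇔∉K K i<j j<k) j∉K) (from lookup∈prefix (n<1+n (toℕ q)))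
                   (after q<p) (after q′<p′)
      where
      after : ∀ {p} → toℕ q <ℕ toℕ p → lookupᵛ v p ∉ₛ prefix v (suc q)
      after q<p vp∈ = <-irrefl refl (<-≤-trans q<p (≤-pred (to lookup∈prefix vp∈)))

-- w-convexity

wconvex⇒noWhiteHole : ∀ {n K X} → WConvex n K X → NoWhiteHole n K X
wconvex⇒noWhiteHole (_ , _ , noHole) i<j j<k white i∈ k∈ j∉ =
  noHole (_ , _ , _ , i<j , j<k , i∈ , k∈ , j∉ , white)

module Convexity {m : ℕ} (K : Subset (suc m)) {X : Subset (suc m)} where

  open Necklace K

  separate : ∀ {x y} → x ∈ₛ X → y ∉ₛ X → x <ᶠ y ⊎ y <ᶠ x
  separate {x} {y} x∈ y∉ with <-cmp x y
  ... | tri< x<y _ _  = inj₁ x<y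
  ... | tri≈ _ refl _ = ⊥-elim (y∉ x∈)
  ... | tri> _ _ y<x  = inj₂ y<x

  module _ (noHole : NoWhiteHole (suc m) K X) (noIsland : NoBlackIsland (suc m) K X) where

    -- In each colour pattern, comparing the beads that the necklace order leaves unrelated exposes
    -- a white hole or a black island.
    alternating-colours : ∀ {a b d e} ca cb cd ce → white a ≡ ca → white b ≡ cb → white d ≡ cd → white e ≡ ce →
      NecklaceOrder ca cb a b → NecklaceOrder cb cd b d → NecklaceOrder cd ce d e → ¬ Alternates X a b d e
    alternating-colours true true true true _ wb _ _ a<b b<d _ (inj₁ (a∈ , b∉ , d∈ , _)) = noHole a<b b<d wb a∈ d∈ b∉
    alternating-colours true true true true _ _ wd _ _ b<d d<e (inj₂ (_ , b∈ , d∉ , e∈)) = noHole b<d d<e wd b∈ e∈ d∉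
    alternating-colours true true true false _ wb _ _ a<b b<d _ (inj₁ (a∈ , b∉ , d∈ , _)) = noHole a<b b<d wb a∈ d∈ b∉
    alternating-colours true true true false wa _ wd be a<b b<d _ (inj₂ (a∉ , b∈ , d∉ , e∈))
      with separate e∈ a∉ | separate e∈ d∉
    ... | inj₁ e<a | _        = noHole e<a a<b wa e∈ b∈ a∉
    ... | inj₂ a<e | inj₁ e<d = noIsland a<e e<d be e∈ a∉ d∉
    ... | inj₂ _   | inj₂ d<e = noHole b<d d<e wd b∈ e∈ d∉
    alternating-colours true true false false _ wb bd _ a<b _ e<d (inj₁ (a∈ , b∉ , d∈ , e∉)) with separate d∈ b∉
    ... | inj₁ d<b = noIsland e<d d<b bd d∈ e∉ b∉
    ... | inj₂ b<d = noHole a<b b<d wb a∈ d∈ b∉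
    alternating-colours true true false false wa _ _ be a<b _ e<d (inj₂ (a∉ , b∈ , d∉ , e∈)) with separate e∈ a∉
    ... | inj₁ e<a = noHole e<a a<b wa e∈ b∈ a∉
    ... | inj₂ a<e = noIsland a<e e<d be e∈ a∉ d∉
    alternating-colours true false false false _ _ bd _ _ d<b e<d (inj₁ (_ , b∉ , d∈ , e∉)) =
      noIsland e<d d<b bd d∈ e∉ b∉
    alternating-colours true false false false wa bb _ be _ d<b e<d (inj₂ (a∉ , b∈ , d∉ , e∈))
      with separate b∈ a∉ | separate e∈ a∉
    ... | inj₁ b<a | _        = noIsland d<b b<a bb b∈ d∉ a∉
    ... | inj₂ a<b | inj₁ e<a = noHole e<a a<b wa e∈ b∈ a∉
    ... | inj₂ _   | inj₂ a<e = noIsland a<e e<d be e∈ a∉ d∉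
    alternating-colours false false false false _ _ bd _ _ d<b e<d (inj₁ (_ , b∉ , d∈ , e∉)) =
      noIsland e<d d<b bd d∈ e∉ b∉
    alternating-colours false false false false _ bb _ _ b<a d<b _ (inj₂ (a∉ , b∈ , d∉ , _)) =
      noIsland d<b b<a bb b∈ d∉ a∉
    alternating-colours false true _     _    _ _ _ _ () _  _
    alternating-colours _     false true _    _ _ _ _ _  () _
    alternating-colours _     _     false true _ _ _ _ _ _  ()

    necklace¬alternates : ∀ {a b d e} → a ∷ b ∷ d ∷ e ∷ [] ⊆ necklace (suc m) K → ¬ Alternates X a b d e
    necklace¬alternates s = alternating-colours _ _ _ _ refl refl refl refl
      (necklace-order (⊆-trans (refl ∷ refl ∷ _ ∷ʳ _ ∷ʳ []) s))
      (necklace-order (⊆-trans (_ ∷ʳ refl ∷ refl ∷ _ ∷ʳ []) s))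
      (necklace-order (∷ˡ⁻ (∷ˡ⁻ s)))

    ¬singleBlack : ¬ (Σ (Fin (suc m)) λ b → Black (suc m) K b × ((y : Fin (suc m)) → (y ∈ₛ X) ⇔ (y ≡ b)))
    ¬singleBlack (b , black , X≈b) with black⇒interior K black
    ... | 0<b , b<m =
      noIsland {zero} {b} {fromℕ m} 0<b (subst (toℕ b <ℕ_) (sym (toℕ-fromℕ m)) b<m) black (from (X≈b b) refl)
               (λ 0∈ → <⇒≢ 0<b (cong toℕ (to (X≈b zero) 0∈)))
               (λ m∈ → <⇒≢ b<m (trans (cong toℕ (sym (to (X≈b (fromℕ m)) m∈))) (toℕ-fromℕ m)))

    noWhiteHole∧noBlackIsland⇒wconvex : WConvex (suc m) K X
    noWhiteHole∧noBlackIsland⇒wconvex =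
      ¬alternates⇒arc _ ∈-necklace necklace¬alternates , ¬singleBlack ,
      λ (_ , _ , _ , i<j , j<k , i∈ , k∈ , j∉ , white) → noHole i<j j<k white i∈ k∈ j∉

  module _ (wconv : WConvex (suc m) K X) {x} (wx : White (suc m) K x) (x∈ : x ∈ₛ X) where

    private
      noHole : NoWhiteHole (suc m) K X
      noHole = wconvex⇒noWhiteHole {K = K} wconv

      ¬alt : ∀ {a b d e} → a ∷ b ∷ d ∷ e ∷ [] ⊆ necklace (suc m) K → ¬ Alternates X a b d e
      ¬alt = arc⇒¬alternates necklace-unique (proj₁ wconv)

    -- The white bead x ∈ X and i, j, l alternate along the necklace unless x exposes a white hole.
    island-colours : ∀ {i j l} ci cl → white i ≡ ci → white l ≡ cl → i <ᶠ j → j <ᶠ l →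
                     Black (suc m) K j → j ∈ₛ X → i ∉ₛ X → l ∉ₛ X → ⊥₀
    island-colours false false bi bl i<j j<l bj j∈ i∉ l∉ =
      ¬alt (necklace-⊆ (wx ∷ []) (from∈ (∈-allFin x)) (bi ∷ bj ∷ bl ∷ []) (tabulate-⊆₃ id i<j j<l))
           (inj₁ (x∈ , l∉ , j∈ , i∉))
    island-colours true false wi bl i<j j<l bj j∈ i∉ l∉ with separate x∈ i∉
    ... | inj₁ x<i = noHole x<i i<j wi x∈ j∈ i∉
    ... | inj₂ i<x = ¬alt (necklace-⊆ (wi ∷ wx ∷ []) (tabulate-⊆₂ id i<x) (bj ∷ bl ∷ []) (tabulate-⊆₂ id j<l))
                          (inj₂ (i∉ , x∈ , l∉ , j∈))
    island-colours false true bi wl i<j j<l bj j∈ i∉ l∉ with separate x∈ l∉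
    ... | inj₂ l<x = noHole j<l l<x wl j∈ x∈ l∉
    ... | inj₁ x<l = ¬alt (necklace-⊆ (wx ∷ wl ∷ []) (tabulate-⊆₂ id x<l) (bi ∷ bj ∷ []) (tabulate-⊆₂ id i<j))
                          (inj₁ (x∈ , l∉ , j∈ , i∉))
    island-colours true true wi wl i<j j<l bj j∈ i∉ l∉ with separate x∈ l∉ | separate x∈ i∉
    ... | inj₂ l<x | _        = noHole j<l l<x wl j∈ x∈ l∉
    ... | inj₁ _   | inj₁ x<i = noHole x<i i<j wi x∈ j∈ i∉
    ... | inj₁ x<l | inj₂ i<x =
      ¬alt (necklace-⊆ (wi ∷ wx ∷ wl ∷ []) (tabulate-⊆₃ id i<x x<l) (bj ∷ []) (from∈ (∈-allFin _)))
           (inj₂ (i∉ , x∈ , l∉ , j∈))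

    wconvex⇒noBlackIsland : NoBlackIsland (suc m) K X
    wconvex⇒noBlackIsland = island-colours _ _ refl refl

module _ {n : ℕ} {K : Subset n} {v : Vec (Fin n) n} where

  prefixFlag : Unique (toList v) → (∀ k → WConvex n K (prefix v (suc k))) → WFlag n K
  prefixFlag u wconvex = record
    { X       = prefix v
    ; size    = ∣prefix∣ u
    ; chain   = λ k y∈ → from (∈-prefix-suc v k) (inj₁ y∈)
    ; top     = LinearOrder.prefix-full u
    ; wconvex = wconvex
    }

  prefixFlag-defines : (u : Unique (toList v)) (wconvex : ∀ k → WConvex n K (prefix v (suc k))) →
                       Defines (prefixFlag u wconvex) v
  prefixFlag-defines u _ k y = mk⇔
    (λ (y∈ , y∉) → [ ⊥-elim ∘ y∉ , id ]′ (to (∈-prefix-suc v k) y∈))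
    (λ { refl → from (∈-prefix-suc v k) (inj₂ refl)
              , λ vk∈ → <-irrefl (sym (toℕ-inject₁ k)) (to (LinearOrder.lookup∈prefix u) vk∈) })

  module _ (F : WFlag n K) (defines : Defines F v) where

    open WFlag F

    flag≡prefix : ∀ k → X k ≡ prefix v k
    flag≡prefix = <-weakInduction (λ k → X k ≡ prefix v k) base step
      where
      base : X zero ≡ ∅
      base = ⊆-antisym (λ y∈ → ⊥-elim (∣p∣≡0⇒∉ (size zero) y∈)) (λ y∈ → ⊥-elim (∉⊥ y∈))
      step : ∀ k → X (inject₁ k) ≡ prefix v (inject₁ k) → X (suc k) ≡ prefix v (suc k)
      step k IH = ⊆-antisym ⊆prefix prefix⊆
        where
        ⊆prefix : ∀ {y} → y ∈ₛ X (suc k) → y ∈ₛ prefix v (suc k)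
        ⊆prefix {y} y∈ with y ∈? X (inject₁ k)
        ... | yes y∈′ = from (∈-prefix-suc v k) (inj₁ (subst (y ∈ₛ_) IH y∈′))
        ... | no  y∉′ = from (∈-prefix-suc v k) (inj₂ (to (defines k y) (y∈ , y∉′)))
        prefix⊆ : ∀ {y} → y ∈ₛ prefix v (suc k) → y ∈ₛ X (suc k)
        prefix⊆ {y} y∈ with to (∈-prefix-suc v k) y∈
        ... | inj₁ y∈′  = chain k (subst (y ∈ₛ_) (sym IH) y∈′)
        ... | inj₂ refl = proj₁ (from (defines k y) refl)

module _ {m : ℕ} {K : Subset (suc m)} {v : Vec (Fin (suc m)) (suc m)}
         (F : WFlag (suc m) K) (defines : Defines F v) where

  top-white : White (suc m) K (lookupᵛ v zero)
  top-white with whiteᵇ (suc m) K (lookupᵛ v zero) in black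
  ... | true  = refl
  ... | false = ⊥-elim (proj₁ (proj₂ (WFlag.wconvex F zero)) (_ , black , X₁≈v₀))
    where
    X₀≡∅ : WFlag.X F zero ≡ ∅
    X₀≡∅ = flag≡prefix {v = v} F defines zero
    X₁≈v₀ : ∀ y → y ∈ₛ WFlag.X F (suc zero) ⇔ y ≡ lookupᵛ v zero
    X₁≈v₀ y = mk⇔ (λ y∈ → to (defines zero y) (y∈ , λ y∈₀ → ∉⊥ (subst (y ∈ₛ_) X₀≡∅ y∈₀)))
                  (λ { refl → proj₁ (from (defines zero y) refl) })

  flag⇒fishburn : Unique (toList v) → FishburnCond (suc m) K v
  flag⇒fishburn u = Fishburn.prefixes⇒fishburn u noHole noIsland
    where
    wconvex : ∀ k → WConvex (suc m) K (prefix v (suc k))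
    wconvex k = subst (WConvex (suc m) K) (flag≡prefix {v = v} F defines (suc k)) (WFlag.wconvex F k)
    noHole : ∀ k → NoWhiteHole (suc m) K (prefix v k)
    noHole zero    _ _ _ i∈ = ⊥-elim (∉⊥ i∈)
    noHole (suc k) = wconvex⇒noWhiteHole {K = K} (wconvex k)
    noIsland : ∀ k → NoBlackIsland (suc m) K (prefix v k)
    noIsland zero    _ _ _ j∈ = ⊥-elim (∉⊥ j∈)
    noIsland (suc k) =
      Convexity.wconvex⇒noBlackIsland K (wconvex k) top-white (∈-prefix⁺ v (suc k) zero (s≤s z≤n))

inFishburn⇒inD : ∀ {m K v} → InFishburn (suc m) K v → InD (suc m) K v
inFishburn⇒inD {m} {K} {v} (u , fish) = u , prefixFlag {K = K} u wconvex , prefixFlag-defines {K = K} u wconvex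
  where
  open Fishburn u
  wconvex : ∀ k → WConvex (suc m) K (prefix v (suc k))
  wconvex k = Convexity.noWhiteHole∧noBlackIsland⇒wconvex K (fishburn⇒noWhiteHole fish (suc k))
                                                              (fishburn⇒noBlackIsland fish (suc k))

inD⇒inFishburn : ∀ {m K v} → InD (suc m) K v → InFishburn (suc m) K v
inD⇒inFishburn (u , F , defines) = u , flag⇒fishburn F defines u

theorem1 : (n : ℕ) → 3 ≤ n → (K : Subset n) → InInterior n K →
    (v : Vec (Fin n) n) → InD n K v ⇔ InFishburn n K v
theorem1 (suc m) _ K _ v = mk⇔ inD⇒inFishburn inFishburn⇒inD
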